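{- Let $G$ be a graph with vertex cover number $k$, let $E_1\subseteq E(G)$, and let $w:E_1\to\{1\}$ be a pre-weighting such that there exists a proper weight function of $G$ extending $w$. Then there exists a proper weight function $\hat w:E(G)\to\{0,1\}$ extending $w$ such that $\mathrm{color}_{\hat w}(v)-\mathrm{base}_w(v)\le 8k^2+8k$ for every $v\in V(G)$.
   Context: Graphs are finite, simple, undirected, with no isolated edges. For $w':E(G)\to\{0,1\}$, $\mathrm{color}_{w'}(v)=\sum_{e\ni v}w'(e)$; $w'$ is proper if $\mathrm{color}_{w'}(u)\neq\mathrm{color}_{w'}(v)$ for every edge $uv\in E(G)$. A function $\hat w:E(G)\to\{0,1\}$ extends $w$ if $\hat w(e)=w(e)$ for all $e\in E_1$. $\mathrm{base}_w(v)$ is the number of edges of $E_1$ incident to $v$ (the color induced on $v$ by the pre-weighting). -}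

module Defs where

open import Data.Nat using (ℕ; _+_; _*_; _≤_; _∸_)
open import Data.Bool using (Bool; true; false; _∧_; if_then_else_)
open import Data.Fin using (Fin)
open import Data.Fin.Subset using (Subset; _∈_; ∣_∣)
open import Data.List using (List; map; allFin)
open import Data.Nat.ListAction using (sum)
open import Data.Sum using (_⊎_)
open import Data.Product using (Σ; _×_; ∃-syntax)
open import Relation.Binary.PropositionalEquality using (_≡_; _≢_)

⟦_⟧ : Bool → ℕ
⟦ b ⟧ = if b then 1 else 0

Σv : {n : ℕ} → (Fin n → ℕ) → ℕ
Σv {n} f = sum (map f (allFin n))

record Graph (n : ℕ) : Set where
  field
    adj   : Fin n → Fin n → Bool
    sym   : ∀ u v → adj u v ≡ adj v u
    irrefl : ∀ v → adj v v ≡ false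
open Graph public

-- Edge-labelled functions E(G) → {0,1} are represented by symmetric functions
-- Fin n → Fin n → Bool (true = 1); values on non-edges are irrelevant.
EdgeFun : ℕ → Set
EdgeFun n = Fin n → Fin n → Bool

Symmetric : {n : ℕ} → EdgeFun n → Set
Symmetric f = ∀ u v → f u v ≡ f v u

degree : {n : ℕ} → Graph n → Fin n → ℕ
degree G v = Σv (λ u → ⟦ adj G v u ⟧)

NoIsolatedEdge : {n : ℕ} → Graph n → Set
NoIsolatedEdge G = ∀ u v → adj G u v ≡ true → (2 ≤ degree G u) ⊎ (2 ≤ degree G v)

color : {n : ℕ} → Graph n → EdgeFun n → Fin n → ℕ
color G w' v = Σv (λ u → ⟦ adj G v u ∧ w' v u ⟧)

IsProperWeighting : {n : ℕ} → Graph n → EdgeFun n → Set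
IsProperWeighting G w' =
  Symmetric w' × (∀ u v → adj G u v ≡ true → color G w' u ≢ color G w' v)

IsEdgeSubset : {n : ℕ} → Graph n → EdgeFun n → Set
IsEdgeSubset G E₁ = Symmetric E₁ × (∀ u v → E₁ u v ≡ true → adj G u v ≡ true)

-- ŵ extends the pre-weighting w : E₁ → {1}, i.e. ŵ(e) = 1 for all e ∈ E₁.
Extends : {n : ℕ} → EdgeFun n → EdgeFun n → Set
Extends E₁ ŵ = ∀ u v → E₁ u v ≡ true → ŵ u v ≡ true

base : {n : ℕ} → Graph n → EdgeFun n → Fin n → ℕ
base G E₁ v = Σv (λ u → ⟦ adj G v u ∧ E₁ v u ⟧)

IsVertexCover : {n : ℕ} → Graph n → Subset n → Set
IsVertexCover G S = ∀ u v → adj G u v ≡ true → (u ∈ S) ⊎ (v ∈ S)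

VertexCoverNumber : {n : ℕ} → Graph n → ℕ → Set
VertexCoverNumber G k =
  (∃[ S ] (IsVertexCover G S × ∣ S ∣ ≡ k)) ×
  (∀ S → IsVertexCover G S → k ≤ ∣ S ∣)

-- Fix a vertex cover S and put k = |S|. A vertex outside S has all its neighbors in S, so its
-- color is at most k; and for ŵ extending the pre-weighting, color ŵ v ∸ base v is the number of
-- free edges at v (weight 1, not in E₁). Among proper extensions we decrease the potential
-- Σ_x (color x ∸ 4k) as long as some v has more than 8k² + 8k free edges. Let F be the free
-- neighbors of v outside S, and say that y ∈ S blocks u ∈ F if uy is an edge and
-- color y + 1 = color u. If more than 2k vertices of F are unblocked, unweight the edges from v
-- to a ≤ 2k + 1 of them, with a chosen by pigeonhole so that the new color of v avoids the colors
-- on S: the colors of these neighbors drop by one without meeting a neighbor's, and v stays above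
-- 4k. Otherwise some y ∈ S blocks more than 8k + 5 vertices of F, all but fewer than k of them joined
-- to y by edges of weight 0; for b of those (k < b ≤ 3k + 1, again chosen by pigeonhole) move the
-- weight of the edge to v onto the edge to y. Their colors are unchanged, v stays above 4k, y rises
-- into (k, 4k], and neither new color meets a color on S.
module Submission where

open import Defs hiding (sym)
open import Data.Bool as Bool using (Bool; true; false; _∧_; _∨_; not; _xor_)
open import Data.Bool.Properties
  using ( ∧-conicalˡ; ∧-conicalʳ; ∧-identityʳ; ∧-zeroʳ; ∧-assoc; ∨-comm; ∨-identityʳ
        ; xor-identityʳ; not-injective)
open import Data.Empty using (⊥; ⊥-elim)
open import Data.Fin using (Fin; zero; suc; toℕ; _≟_)
open import Data.Fin.Properties using (all?; any?; ¬∀⟶∃¬; pigeonhole; toℕ≤pred[n])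
open import Data.Fin.Subset using (Subset; ∣_∣)
open import Data.List using (List; []; _∷_; allFin; tabulate; map; length; _++_)
import Data.List as List
open import Data.List.Membership.Propositional using (_∈_; _∉_)
open import Data.List.Membership.Propositional.Properties using (∈-map⁺; ∈-++⁺ˡ; ∈-++⁺ʳ)
open import Data.List.Properties using (map-cong; map-tabulate; length-map; length-++)
open import Data.List.Relation.Unary.Any using (here; there; index)
open import Data.List.Relation.Unary.Any.Properties using (lookup-index)
open import Data.Nat using (ℕ; zero; suc; _+_; _*_; _≤_; _<_; _∸_; z≤n; s≤s)
open import Data.Nat.Induction using (<-wellFounded)
import Data.Nat.ListAction as ℕ-List
open import Data.Nat.Properties hiding (_≟_)
open import Data.Nat.Properties using () renaming (_≟_ to _≟ℕ_)
open import Algebra.Properties.Semiring.Sum +-*-semiring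
  using (sum; sum-syntax; sum-cong-≗; sum-replicate-zero; ∑-distrib-+; ∑-comm; *-distribʳ-sum)
open import Data.Nat.Tactic.RingSolver using (solve)
open import Data.List.Membership.DecPropositional _≟ℕ_ using (_∈?_)
open import Data.Product using (_×_; _,_; proj₁; proj₂; ∃-syntax)
open import Data.Sum as Sum using (_⊎_; inj₁; inj₂; [_,_]′)
open import Data.Vec as Vec using (lookup)
open import Data.Vec.Properties using ([]=⇒lookup)
open import Function using (id; _∘_; flip; case_of_)
open import Induction.WellFounded using (Acc; acc)
open import Relation.Binary.PropositionalEquality
open import Relation.Nullary using (Dec; yes; no; contradiction; _×-dec_)
open import Relation.Nullary.Decidable using (does; dec-true)

does⇒ : ∀ {P : Set} (P? : Dec P) → does P? ≡ true → P
does⇒ (yes p) _ = p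

Σv≡∑ : ∀ {n} (f : Fin n → ℕ) → Σv f ≡ ∑[ x < n ] f x
Σv≡∑ f = trans (cong ℕ-List.sum (map-tabulate id f)) (sum-tabulate f)
  where
  sum-tabulate : ∀ {n} (f : Fin n → ℕ) → ℕ-List.sum (tabulate f) ≡ sum f
  sum-tabulate {zero}  f = refl
  sum-tabulate {suc n} f = cong (f zero +_) (sum-tabulate (f ∘ suc))

sum-mono-≤ : ∀ {n} {f g : Fin n → ℕ} → (∀ x → f x ≤ g x) → sum f ≤ sum g
sum-mono-≤ {zero}  f≤g = z≤n
sum-mono-≤ {suc n} f≤g = +-mono-≤ (f≤g zero) (sum-mono-≤ (f≤g ∘ suc))

sum-mono-< : ∀ {n} {f g : Fin n → ℕ} → (∀ x → f x ≤ g x) → ∀ x → f x < g x → sum f < sum g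
sum-mono-< f≤g zero    fx<gx = +-mono-<-≤ fx<gx (sum-mono-≤ (f≤g ∘ suc))
sum-mono-< f≤g (suc x) fx<gx = +-mono-≤-< (f≤g zero) (sum-mono-< (f≤g ∘ suc) x fx<gx)

term≤sum : ∀ {n} (f : Fin n → ℕ) x → f x ≤ sum f
term≤sum f zero    = m≤m+n _ _
term≤sum f (suc x) = ≤-trans (term≤sum (f ∘ suc) x) (m≤n+m _ _)

count : ∀ {n} → (Fin n → Bool) → ℕ
count P = sum (⟦_⟧ ∘ P)

count-cong : ∀ {n} {P Q : Fin n → Bool} → (∀ x → P x ≡ Q x) → count P ≡ count Q
count-cong P≗Q = sum-cong-≗ (cong ⟦_⟧ ∘ P≗Q)

count-lookup : ∀ {n} (S : Subset n) → count (lookup S) ≡ ∣ S ∣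
count-lookup Vec.[]          = refl
count-lookup (true  Vec.∷ S) = cong suc (count-lookup S)
count-lookup (false Vec.∷ S) = count-lookup S

member⇒count>0 : ∀ {n} (P : Fin n → Bool) {x} → P x ≡ true → 0 < count P
member⇒count>0 P {x} Px = ≤-trans (≤-reflexive (cong ⟦_⟧ (sym Px))) (term≤sum (⟦_⟧ ∘ P) x)

count>0⇒member : ∀ {n} (P : Fin n → Bool) → 0 < count P → ∃[ x ] P x ≡ true
count>0⇒member {suc n} P pos with P zero in P₀
... | true  = zero , P₀
... | false = let x , Px = count>0⇒member (P ∘ suc) pos in suc x , Px

count-∧-true : ∀ {n} {P Q : Fin n → Bool} → (∀ z → P z ≡ true → Q z ≡ true) →
               count (λ z → P z ∧ Q z) ≡ count P
count-∧-true {P = P} {Q} P⊆Q = count-cong pointwise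
  where
  pointwise : ∀ z → P z ∧ Q z ≡ P z
  pointwise z with P z in Pz
  ... | true  = P⊆Q z Pz
  ... | false = refl

count-∧-false : ∀ {n} {P Q : Fin n → Bool} → (∀ z → P z ≡ true → Q z ≡ false) →
                count (λ z → P z ∧ Q z) ≡ 0
count-∧-false {n} {P} {Q} P∩Q≡∅ = trans (count-cong pointwise) (sum-replicate-zero n)
  where
  pointwise : ∀ z → P z ∧ Q z ≡ false
  pointwise z with P z in Pz
  ... | true  = P∩Q≡∅ z Pz
  ... | false = refl

count-singleton : ∀ {n} (P : Fin n → Bool) v → count (λ z → P z ∧ does (z ≟ v)) ≡ ⟦ P v ⟧
count-singleton {suc n} P zero rewrite ∧-identityʳ (P zero) =
  trans (cong (⟦ P zero ⟧ +_) (trans (count-cong (∧-zeroʳ ∘ P ∘ suc)) (sum-replicate-zero n)))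
        (+-identityʳ _)
count-singleton {suc n} P (suc v) rewrite ∧-zeroʳ (P zero) = count-singleton (P ∘ suc) v

subset-ofSize : ∀ {n} (P : Fin n → Bool) {b} → b ≤ count P →
                ∃[ Q ] ((∀ x → Q x ≡ true → P x ≡ true) × count Q ≡ b)
subset-ofSize {zero}  P z≤n = P , (λ _ → id) , refl
subset-ofSize {suc n} P {zero} _ = (λ _ → false) , (λ _ ()) , sum-replicate-zero (suc n)
subset-ofSize {suc n} P {suc b} b<P with P zero in P₀
... | true  = let Q , Q⊆P , ∣Q∣ = subset-ofSize (P ∘ suc) (≤-pred b<P) in
  (λ { zero → true ; (suc x) → Q x }) , (λ { zero _ → P₀ ; (suc x) → Q⊆P x }) , cong suc ∣Q∣
... | false = let Q , Q⊆P , ∣Q∣ = subset-ofSize (P ∘ suc) b<P in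
  (λ { zero → false ; (suc x) → Q x }) , (λ { zero () ; (suc x) → Q⊆P x }) , ∣Q∣

-- If s, s + 1, …, s + length xs all occurred in xs, two of them would share a position.
fresh-offset : ∀ s (xs : List ℕ) → ∃[ t ] (t ≤ length xs × s + t ∉ xs)
fresh-offset s xs with all? (λ (i : Fin (suc (length xs))) → s + toℕ i ∈? xs)
... | no ¬all = let i , i∉xs = ¬∀⟶∃¬ _ _ (λ i → s + toℕ i ∈? xs) ¬all in
  toℕ i , toℕ≤pred[n] i , i∉xs
... | yes all = let i , j , i<j , same-position = pigeonhole ≤-refl (λ i → index (all i)) in
  contradiction (+-cancelˡ-≡ s _ _ (begin
    s + toℕ i                           ≡⟨ lookup-index (all i) ⟩
    List.lookup xs (index (all i))      ≡⟨ cong (List.lookup xs) same-position ⟩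
    List.lookup xs (index (all j))      ≡⟨ lookup-index (all j) ⟨
    s + toℕ j                           ∎))
    (<⇒≢ i<j)
  where open ≡-Reasoning

members : ∀ {n} → Subset n → List (Fin n)
members Vec.[]          = []
members (true  Vec.∷ S) = zero ∷ map suc (members S)
members (false Vec.∷ S) = map suc (members S)

length-members : ∀ {n} (S : Subset n) → length (members S) ≡ ∣ S ∣
length-members Vec.[]          = refl
length-members (true  Vec.∷ S) = cong suc (trans (length-map suc (members S)) (length-members S))
length-members (false Vec.∷ S) = trans (length-map suc (members S)) (length-members S)

∈-members : ∀ {n} (S : Subset n) {x} → lookup S x ≡ true → x ∈ members S
∈-members (true  Vec.∷ S) {zero}  _   = here refl
∈-members (true  Vec.∷ S) {suc x} x∈S = there (∈-map⁺ suc (∈-members S x∈S))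
∈-members (false Vec.∷ S) {suc x} x∈S = ∈-map⁺ suc (∈-members S x∈S)

fresh-offset-avoiding : ∀ {n} s (S : Subset n) (f g : Fin n → ℕ) →
                        ∃[ t ] (t ≤ ∣ S ∣ + ∣ S ∣ ×
                                (∀ x → lookup S x ≡ true → f x ≢ s + t × g x ≢ s + t))
fresh-offset-avoiding s S f g =
  let t , t≤ , t∉ = fresh-offset s (values f ++ values g) in
  t , subst (t ≤_) length-values t≤ , avoids t∉
  where
  values : (Fin _ → ℕ) → List ℕ
  values h = map h (members S)
  length-values : length (values f ++ values g) ≡ ∣ S ∣ + ∣ S ∣
  length-values = trans (length-++ (values f))
    (cong₂ _+_ (trans (length-map f (members S)) (length-members S))
               (trans (length-map g (members S)) (length-members S)))
  avoids : ∀ {t} → s + t ∉ values f ++ values g →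
           ∀ x → lookup S x ≡ true → f x ≢ s + t × g x ≢ s + t
  avoids t∉ x x∈S =
      (λ fx≡ → t∉ (subst (_∈ values f ++ values g) fx≡ (∈-++⁺ˡ (∈-map⁺ f x∈ms))))
    , (λ gx≡ → t∉ (subst (_∈ values f ++ values g) gx≡ (∈-++⁺ʳ (values f) (∈-map⁺ g x∈ms))))
    where
    x∈ms : x ∈ members S
    x∈ms = ∈-members S x∈S

descend : {A : Set} {P Q : A → Set} (μ : A → ℕ) →
          (∀ x → P x → Q x ⊎ ∃[ y ] (P y × μ y < μ x)) →
          ∀ x → P x → ∃[ y ] (P y × Q y)
descend {P = P} {Q} μ step x Px = go x Px (<-wellFounded (μ x))
  where
  go : ∀ x → P x → Acc _<_ (μ x) → ∃[ y ] (P y × Q y)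
  go x Px (acc smaller) with step x Px
  ... | inj₁ Qx               = x , Px , Qx
  ... | inj₂ (y , Py , μy<μx) = go y Py (smaller μy<μx)

m<o∧n<o⇒m∸n<o∸n : ∀ {m n o} → m < o → n < o → m ∸ n < o ∸ n
m<o∧n<o⇒m∸n<o∸n {m} {n} m<o n<o with ≤-total n m
... | inj₁ n≤m = ∸-monoˡ-< m<o n≤m
... | inj₂ m≤n rewrite m≤n⇒m∸n≡0 m≤n = m<n⇒0<n∸m n<o

t≤k+k⇒t≤2k : ∀ k {t} → t ≤ k + k → t ≤ 2 * k
t≤k+k⇒t≤2k k t≤ = ≤-trans t≤ (≤-reflexive (solve (k ∷ [])))

1+2k≤3k+1 : ∀ k → suc (2 * k) ≤ 3 * k + 1
1+2k≤3k+1 k = ≤-trans (s≤s (*-monoˡ-≤ k {2} {3} (s≤s (s≤s z≤n)))) (≤-reflexive (+-comm 1 (3 * k)))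

1+k+t≤3k+1 : ∀ k {t} → t ≤ k + k → suc k + t ≤ 3 * k + 1
1+k+t≤3k+1 k t≤ = ≤-trans (+-monoʳ-≤ (suc k) t≤) (≤-reflexive identity)
  where
  identity : 1 + k + (k + k) ≡ 3 * k + 1
  identity = solve (k ∷ [])

high-after-unloading : ∀ k {b c′} → 1 ≤ k → b ≤ 3 * k + 1 →
                       8 * (k * k) + 8 * k < c′ + b → 4 * k < c′
high-after-unloading k {b} {c′} k≥1 b≤ big = +-cancelʳ-< b (4 * k) c′ (begin-strict
  4 * k + b                ≤⟨ +-monoʳ-≤ (4 * k) b≤ ⟩
  4 * k + (3 * k + 1)      ≡⟨ solve (k ∷ []) ⟩
  7 * k + 1                ≤⟨ +-monoʳ-≤ (7 * k) k≥1 ⟩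
  7 * k + k                ≡⟨ solve (k ∷ []) ⟩
  8 * k                    ≤⟨ m≤n+m (8 * k) (8 * (k * k)) ⟩
  8 * (k * k) + 8 * k      <⟨ big ⟩
  c′ + b                   ∎)
  where open ≤-Reasoning

low-after-loading : ∀ k {c b} → c < k → b ≤ 3 * k + 1 → c + b ≤ 4 * k
low-after-loading k c<k b≤ = ≤-pred (≤-trans (+-mono-≤ c<k b≤) (≤-reflexive identity))
  where
  identity : k + (3 * k + 1) ≡ 1 + 4 * k
  identity = solve (k ∷ [])

light-loads-bound : ∀ k {d f u l} → d ≤ f + k → f ≤ u + l → u ≤ 2 * k → l ≤ k * (8 * k + 5) →
                    d ≤ 8 * (k * k) + 8 * k
light-loads-bound k {d} {f} {u} {l} d≤ f≤ u≤ l≤ = begin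
  d                                 ≤⟨ d≤ ⟩
  f + k                             ≤⟨ +-monoˡ-≤ k (≤-trans f≤ (+-mono-≤ u≤ l≤)) ⟩
  2 * k + k * (8 * k + 5) + k       ≡⟨ solve (k ∷ []) ⟩
  8 * (k * k) + 8 * k               ∎
  where open ≤-Reasoning

heavy-load-leaves-room : ∀ k {l u c} → 8 * k + 5 < l → l ≤ u + c → c < k → 3 * k + 1 ≤ u
heavy-load-leaves-room k {l} {u} {c} heavy l≤ c<k = +-cancelʳ-≤ k (3 * k + 1) u (begin
  3 * k + 1 + k                ≤⟨ m≤m+n (3 * k + 1 + k) (4 * k + 4) ⟩
  3 * k + 1 + k + (4 * k + 4)  ≡⟨ solve (k ∷ []) ⟩
  8 * k + 5                    <⟨ heavy ⟩
  l                            ≤⟨ l≤ ⟩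
  u + c                        ≤⟨ +-monoʳ-≤ u (<⇒≤ c<k) ⟩
  u + k                        ∎)
  where open ≤-Reasoning

IsProperColoring : ∀ {n} → Graph n → (Fin n → ℕ) → Set
IsProperColoring G c = ∀ u v → adj G u v ≡ true → c u ≢ c v

adj-sym : ∀ {n} (G : Graph n) {u v} → adj G u v ≡ true → adj G v u ≡ true
adj-sym G {u} {v} uv = trans (Graph.sym G v u) uv

adj⇒≢ : ∀ {n} (G : Graph n) {u v} → adj G u v ≡ true → u ≢ v
adj⇒≢ G {u} uv refl = contradiction (trans (sym uv) (irrefl G u)) λ ()

recolor-proper : ∀ {n} {G : Graph n} {c c′ : Fin n → ℕ} (Changed : Fin n → Set) →
                 (∀ x → Changed x ⊎ c′ x ≡ c x) →
                 (∀ p q → adj G p q ≡ true → Changed p → c′ p ≢ c′ q) →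
                 IsProperColoring G c → IsProperColoring G c′
recolor-proper {G = G} {c} {c′} Changed changed-or-same changed-ok proper p q pq
  with changed-or-same p | changed-or-same q
... | inj₁ p-changed | _              = changed-ok p q pq p-changed
... | inj₂ _         | inj₁ q-changed = changed-ok q p (adj-sym G pq) q-changed ∘ sym
... | inj₂ p-same    | inj₂ q-same    = λ c′p≡c′q → proper p q pq (begin
  c p   ≡⟨ p-same ⟨
  c′ p  ≡⟨ c′p≡c′q ⟩
  c′ q  ≡⟨ q-same ⟩
  c q   ∎)
  where open ≡-Reasoning

color≡∑ : ∀ {n} (G : Graph n) w x → color G w x ≡ ∑[ z < n ] ⟦ adj G x z ∧ w x z ⟧
color≡∑ G w x = Σv≡∑ (λ z → ⟦ adj G x z ∧ w x z ⟧)

color-cong : ∀ {n} (G : Graph n) {w w′ : EdgeFun n} {x} → (∀ z → w x z ≡ w′ x z) →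
             color G w x ≡ color G w′ x
color-cong G {x = x} w≗w′ =
  cong ℕ-List.sum (map-cong (λ z → cong (λ b → ⟦ adj G x z ∧ b ⟧) (w≗w′ z)) (allFin _))

free : ∀ {n} → Graph n → EdgeFun n → EdgeFun n → Fin n → Fin n → Bool
free G E₁ w v z = adj G v z ∧ (w v z ∧ not (E₁ v z))

freeDegree : ∀ {n} → Graph n → EdgeFun n → EdgeFun n → Fin n → ℕ
freeDegree G E₁ w v = count (free G E₁ w v)

color-split : ∀ {n} (G : Graph n) (E₁ w : EdgeFun n) → Extends E₁ w →
              ∀ v → color G w v ≡ base G E₁ v + freeDegree G E₁ w v
color-split {n} G E₁ w extends v = begin
  color G w v                                     ≡⟨ color≡∑ G w v ⟩
  ∑[ z < n ] ⟦ adj G v z ∧ w v z ⟧               ≡⟨ sum-cong-≗ split ⟩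
  ∑[ z < n ] (based z + ⟦ free G E₁ w v z ⟧)      ≡⟨ ∑-distrib-+ based _ ⟩
  sum based + freeDegree G E₁ w v                 ≡⟨ cong (_+ freeDegree G E₁ w v) (Σv≡∑ based) ⟨
  base G E₁ v + freeDegree G E₁ w v               ∎
  where
  open ≡-Reasoning
  based : Fin n → ℕ
  based z = ⟦ adj G v z ∧ E₁ v z ⟧
  split : ∀ z → ⟦ adj G v z ∧ w v z ⟧ ≡ based z + ⟦ free G E₁ w v z ⟧
  split z with adj G v z | E₁ v z in e | w v z in wvz
  ... | false | _     | _     = refl
  ... | true  | false | false = refl
  ... | true  | false | true  = refl
  ... | true  | true  | true  = refl
  ... | true  | true  | false = contradiction (trans (sym (extends v z e)) wvz) λ ()

color∸base≡freeDegree : ∀ {n} (G : Graph n) (E₁ w : EdgeFun n) → Extends E₁ w →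
                        ∀ v → color G w v ∸ base G E₁ v ≡ freeDegree G E₁ w v
color∸base≡freeDegree G E₁ w extends v =
  trans (cong (_∸ base G E₁ v) (color-split G E₁ w extends v)) (m+n∸m≡n (base G E₁ v) _)

unweighted⇒∉E₁ : ∀ {n} {E₁ w : EdgeFun n} → Extends E₁ w →
                 ∀ {x z} → w x z ≡ false → E₁ x z ≡ false
unweighted⇒∉E₁ {E₁ = E₁} extends {x} {z} xz-off with E₁ x z in xz∈E₁
... | false = refl
... | true  = contradiction (trans (sym (extends x z xz∈E₁)) xz-off) λ ()

color-xor : ∀ {n} (G : Graph n) (w T : EdgeFun n) x →
            color G (λ a b → w a b xor T a b) x + count (λ z → adj G x z ∧ (w x z ∧ T x z))
            ≡ color G w x + count (λ z → adj G x z ∧ (not (w x z) ∧ T x z))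
color-xor {n} G w T x = begin
  color G w′ x + count lost               ≡⟨ cong (_+ count lost) (color≡∑ G w′ x) ⟩
  sum new + count lost                    ≡⟨ ∑-distrib-+ new (⟦_⟧ ∘ lost) ⟨
  ∑[ z < n ] (new z + ⟦ lost z ⟧)         ≡⟨ sum-cong-≗ (λ z → pointwise (adj G x z) (w x z) (T x z)) ⟩
  ∑[ z < n ] (old z + ⟦ gained z ⟧)       ≡⟨ ∑-distrib-+ old (⟦_⟧ ∘ gained) ⟩
  sum old + count gained                  ≡⟨ cong (_+ count gained) (color≡∑ G w x) ⟨
  color G w x + count gained              ∎
  where
  open ≡-Reasoning
  w′ : EdgeFun n
  w′ a b = w a b xor T a b
  lost gained : Fin n → Bool
  lost   z = adj G x z ∧ (w x z ∧ T x z)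
  gained z = adj G x z ∧ (not (w x z) ∧ T x z)
  new old : Fin n → ℕ
  new z = ⟦ adj G x z ∧ w′ x z ⟧
  old z = ⟦ adj G x z ∧ w x z ⟧
  pointwise : ∀ a b t →
              ⟦ a ∧ (b xor t) ⟧ + ⟦ a ∧ (b ∧ t) ⟧ ≡ ⟦ a ∧ b ⟧ + ⟦ a ∧ (not b ∧ t) ⟧
  pointwise false _     _     = refl
  pointwise true  false false = refl
  pointwise true  false true  = refl
  pointwise true  true  false = refl
  pointwise true  true  true  = refl

module Toggle {n} (G : Graph n) (w : EdgeFun n) (v : Fin n) (A : Fin n → Bool)
              (A⊆N : ∀ z → A z ≡ true → adj G v z ≡ true) where

  star : EdgeFun n
  star x z = (does (x ≟ v) ∧ A z) ∨ (does (z ≟ v) ∧ A x)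

  toggled : EdgeFun n
  toggled x z = w x z xor star x z

  v∉A : A v ≡ false
  v∉A with A v in Av
  ... | false = refl
  ... | true  = contradiction (trans (sym (A⊆N v Av)) (irrefl G v)) λ ()

  unstarred : ∀ x z → (x ≡ v → A z ≡ false) → (z ≡ v → A x ≡ false) → star x z ≡ false
  unstarred x z x≡v⇒ z≡v⇒ with x ≟ v | z ≟ v
  ... | yes x≡v | yes z≡v rewrite x≡v⇒ x≡v | z≡v⇒ z≡v = refl
  ... | yes x≡v | no  _   rewrite x≡v⇒ x≡v = refl
  ... | no  _   | yes z≡v rewrite z≡v⇒ z≡v = refl
  ... | no  _   | no  _   = refl

  star-center : ∀ z → star v z ≡ A z
  star-center z with v ≟ v | z ≟ v
  ... | no v≢v | _        = contradiction refl v≢v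
  ... | yes _  | yes refl rewrite v∉A = refl
  ... | yes _  | no  _    = ∨-identityʳ (A z)

  star-member : ∀ {x} → A x ≡ true → ∀ z → star x z ≡ does (z ≟ v)
  star-member {x} Ax z with x ≟ v
  ... | yes refl = contradiction (trans (sym Ax) v∉A) λ ()
  ... | no  _ rewrite Ax = ∧-identityʳ _

  toggled-sym : Symmetric w → Symmetric toggled
  toggled-sym w-sym x z = cong₂ _xor_ (w-sym x z) (∨-comm (does (x ≟ v) ∧ A z) _)

  toggled-extends : ∀ {E₁} → Symmetric E₁ → Extends E₁ w →
                    (∀ z → A z ≡ true → E₁ v z ≡ false) → Extends E₁ toggled
  toggled-extends {E₁} E₁-sym extends A∩E₁≡∅ x z xz∈E₁ = begin
    w x z xor star x z  ≡⟨ cong (w x z xor_) (unstarred x z at-x at-z) ⟩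
    w x z xor false     ≡⟨ xor-identityʳ (w x z) ⟩
    w x z               ≡⟨ extends x z xz∈E₁ ⟩
    true                ∎
    where
    open ≡-Reasoning
    outside-A : ∀ {u} → E₁ v u ≡ true → A u ≡ false
    outside-A {u} vu∈E₁ with A u in Au
    ... | false = refl
    ... | true  = contradiction (trans (sym vu∈E₁) (A∩E₁≡∅ u Au)) λ ()
    at-x : x ≡ v → A z ≡ false
    at-x x≡v = outside-A (subst (λ x → E₁ x z ≡ true) x≡v xz∈E₁)
    at-z : z ≡ v → A x ≡ false
    at-z z≡v = outside-A (trans (E₁-sym v x) (subst (λ z → E₁ x z ≡ true) z≡v xz∈E₁))

  toggled-other : ∀ {x} → x ≢ v → A x ≡ false → ∀ z → toggled x z ≡ w x z
  toggled-other {x} x≢v Ax z =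
    trans (cong (w x z xor_) (unstarred x z (flip contradiction x≢v) (λ _ → Ax))) (xor-identityʳ (w x z))

  color-center : color G toggled v + count (λ z → A z ∧ w v z)
                 ≡ color G w v + count (λ z → A z ∧ not (w v z))
  color-center = subst₂ (λ l g → color G toggled v + l ≡ color G w v + g)
                        (at-center (w v)) (at-center (not ∘ w v)) (color-xor G w star v)
    where
    restrict : ∀ a b t → (t ≡ true → a ≡ true) → a ∧ (b ∧ t) ≡ t ∧ b
    restrict false _     false _   = refl
    restrict true  false false _   = refl
    restrict true  true  false _   = refl
    restrict true  false true  _   = refl
    restrict true  true  true  _   = refl
    restrict false _     true  t⇒a = contradiction (t⇒a refl) λ ()
    at-center : (b : Fin n → Bool) →
                count (λ z → adj G v z ∧ (b z ∧ star v z)) ≡ count (λ z → A z ∧ b z)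
    at-center b = count-cong λ z → trans (cong (λ t → adj G v z ∧ (b z ∧ t)) (star-center z))
                                         (restrict (adj G v z) (b z) (A z) (A⊆N z))

  color-member : ∀ {x} → A x ≡ true →
                 color G toggled x + ⟦ w x v ⟧ ≡ color G w x + ⟦ not (w x v) ⟧
  color-member {x} Ax = subst₂ (λ l g → color G toggled x + l ≡ color G w x + g)
                               (at-member (w x)) (at-member (not ∘ w x)) (color-xor G w star x)
    where
    open ≡-Reasoning
    at-member : (b : Fin n → Bool) → count (λ z → adj G x z ∧ (b z ∧ star x z)) ≡ ⟦ b v ⟧
    at-member b = begin
      count (λ z → adj G x z ∧ (b z ∧ star x z))
        ≡⟨ count-cong reassociate ⟩
      count (λ z → (adj G x z ∧ b z) ∧ does (z ≟ v))
        ≡⟨ count-singleton (λ z → adj G x z ∧ b z) v ⟩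
      ⟦ adj G x v ∧ b v ⟧
        ≡⟨ cong (λ a → ⟦ a ∧ b v ⟧) (adj-sym G (A⊆N x Ax)) ⟩
      ⟦ b v ⟧
        ∎
      where
      reassociate : ∀ z → adj G x z ∧ (b z ∧ star x z) ≡ (adj G x z ∧ b z) ∧ does (z ≟ v)
      reassociate z = trans (cong (λ t → adj G x z ∧ (b z ∧ t)) (star-member Ax z))
                            (sym (∧-assoc (adj G x z) (b z) _))

  color-other : ∀ {x} → x ≢ v → A x ≡ false → color G toggled x ≡ color G w x
  color-other x≢v Ax = color-cong G {toggled} {w} (toggled-other x≢v Ax)

  color-changes : ∀ x → (x ≡ v ⊎ A x ≡ true) ⊎ color G toggled x ≡ color G w x
  color-changes x = classify (x ≟ v) (A x) refl
    where
    classify : Dec (x ≡ v) → ∀ b → A x ≡ b →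
               (x ≡ v ⊎ A x ≡ true) ⊎ color G toggled x ≡ color G w x
    classify (yes x≡v) _     _  = inj₁ (inj₁ x≡v)
    classify (no  _)   true  Ax = inj₁ (inj₂ Ax)
    classify (no  x≢v) false Ax = inj₂ (color-other x≢v Ax)

  removal-center : (∀ z → A z ≡ true → w v z ≡ true) → color G toggled v + count A ≡ color G w v
  removal-center A-on = begin
    color G toggled v + count A
      ≡⟨ cong (color G toggled v +_) (count-∧-true A-on) ⟨
    color G toggled v + count (λ z → A z ∧ w v z)
      ≡⟨ color-center ⟩
    color G w v + count (λ z → A z ∧ not (w v z))
      ≡⟨ cong (color G w v +_) (count-∧-false (λ z → cong not ∘ A-on z)) ⟩
    color G w v + 0
      ≡⟨ +-identityʳ _ ⟩
    color G w v
      ∎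
    where open ≡-Reasoning

  addition-center : (∀ z → A z ≡ true → w v z ≡ false) → color G toggled v ≡ color G w v + count A
  addition-center A-off = begin
    color G toggled v
      ≡⟨ +-identityʳ _ ⟨
    color G toggled v + 0
      ≡⟨ cong (color G toggled v +_) (count-∧-false A-off) ⟨
    color G toggled v + count (λ z → A z ∧ w v z)
      ≡⟨ color-center ⟩
    color G w v + count (λ z → A z ∧ not (w v z))
      ≡⟨ cong (color G w v +_) (count-∧-true (λ z → cong not ∘ A-off z)) ⟩
    color G w v + count A
      ∎
    where open ≡-Reasoning

  removal-member : Symmetric w → (∀ z → A z ≡ true → w v z ≡ true) →
                   ∀ {x} → A x ≡ true → color G toggled x + 1 ≡ color G w x
  removal-member w-sym A-on {x} Ax = begin
    color G toggled x + 1              ≡⟨ cong (λ b → color G toggled x + ⟦ b ⟧) xv-on ⟨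
    color G toggled x + ⟦ w x v ⟧      ≡⟨ color-member Ax ⟩
    color G w x + ⟦ not (w x v) ⟧      ≡⟨ cong (λ b → color G w x + ⟦ not b ⟧) xv-on ⟩
    color G w x + 0                    ≡⟨ +-identityʳ _ ⟩
    color G w x                        ∎
    where
    open ≡-Reasoning
    xv-on : w x v ≡ true
    xv-on = trans (w-sym x v) (A-on x Ax)

  addition-member : Symmetric w → (∀ z → A z ≡ true → w v z ≡ false) →
                    ∀ {x} → A x ≡ true → color G toggled x ≡ color G w x + 1
  addition-member w-sym A-off {x} Ax = begin
    color G toggled x                  ≡⟨ +-identityʳ _ ⟨
    color G toggled x + 0              ≡⟨ cong (λ b → color G toggled x + ⟦ b ⟧) xv-off ⟨
    color G toggled x + ⟦ w x v ⟧      ≡⟨ color-member Ax ⟩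
    color G w x + ⟦ not (w x v) ⟧      ≡⟨ cong (λ b → color G w x + ⟦ not b ⟧) xv-off ⟩
    color G w x + 1                    ∎
    where
    open ≡-Reasoning
    xv-off : w x v ≡ false
    xv-off = trans (w-sym x v) (A-off x Ax)

module Rebalancing {n} (G : Graph n) (E₁ : EdgeFun n) (E₁-sym : Symmetric E₁)
                   (S : Subset n) (cover : IsVertexCover G S) where

  k : ℕ
  k = ∣ S ∣

  inCover : Fin n → Bool
  inCover = lookup S

  cover′ : ∀ u z → adj G u z ≡ true → inCover u ≡ true ⊎ inCover z ≡ true
  cover′ u z uz = Sum.map []=⇒lookup []=⇒lookup (cover u z uz)

  edge⇒k≥1 : ∀ {u z} → adj G u z ≡ true → 1 ≤ k
  edge⇒k≥1 {u} {z} uz = subst (1 ≤_) (count-lookup S) ([ nonempty , nonempty ]′ (cover′ u z uz))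
    where
    nonempty : ∀ {x} → inCover x ≡ true → 0 < count inCover
    nonempty = member⇒count>0 inCover

  neighbor-in-cover : ∀ {u z} → inCover u ≡ false → adj G u z ≡ true → inCover z ≡ true
  neighbor-in-cover {u} {z} u∉S uz with cover′ u z uz
  ... | inj₁ u∈S = contradiction (trans (sym u∈S) u∉S) λ ()
  ... | inj₂ z∈S = z∈S

  color-outside-cover : ∀ w {x} → inCover x ≡ false → color G w x ≤ k
  color-outside-cover w {x} x∉S = begin
    color G w x                       ≡⟨ color≡∑ G w x ⟩
    ∑[ z < n ] ⟦ adj G x z ∧ w x z ⟧  ≤⟨ sum-mono-≤ edge⇒cover ⟩
    count inCover                     ≡⟨ count-lookup S ⟩
    k                                 ∎
    where
    open ≤-Reasoning
    edge⇒cover : ∀ z → ⟦ adj G x z ∧ w x z ⟧ ≤ ⟦ inCover z ⟧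
    edge⇒cover z with adj G x z in xz | w x z
    ... | false | _     = z≤n
    ... | true  | false = z≤n
    ... | true  | true  rewrite neighbor-in-cover x∉S xz = ≤-refl

  ProperExtension : EdgeFun n → Set
  ProperExtension w = IsProperWeighting G w × Extends E₁ w

  excess : EdgeFun n → ℕ
  excess w = ∑[ x < n ] (color G w x ∸ 4 * k)

  excess-< : ∀ {w w′} → (∀ x → color G w′ x ∸ 4 * k ≤ color G w x ∸ 4 * k) →
             ∀ v → color G w′ v < color G w v → 4 * k < color G w v → excess w′ < excess w
  excess-< pointwise v w′v<wv 4k<wv = sum-mono-< pointwise v (m<o∧n<o⇒m∸n<o∸n w′v<wv 4k<wv)

  module Overloaded (w : EdgeFun n) (w-proper-ext : ProperExtension w) (v : Fin n)
                    (overloaded : 8 * (k * k) + 8 * k < freeDegree G E₁ w v) where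

    w-sym : Symmetric w
    w-sym = proj₁ (proj₁ w-proper-ext)

    w-proper : IsProperColoring G (color G w)
    w-proper = proj₂ (proj₁ w-proper-ext)

    w-ext : Extends E₁ w
    w-ext = proj₂ w-proper-ext

    c : Fin n → ℕ
    c = color G w

    cv>bound : 8 * (k * k) + 8 * k < c v
    cv>bound = ≤-trans overloaded
                       (≤-trans (m≤n+m _ (base G E₁ v)) (≤-reflexive (sym (color-split G E₁ w w-ext v))))

    k≥1 : 1 ≤ k
    k≥1 = let z , vz-free = count>0⇒member (free G E₁ w v) (≤-trans (s≤s z≤n) overloaded) in
          edge⇒k≥1 (∧-conicalˡ (adj G v z) _ vz-free)

    F : Fin n → Bool
    F u = free G E₁ w v u ∧ not (inCover u)

    F-member : ∀ {u} → F u ≡ true →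
               adj G v u ≡ true × w v u ≡ true × E₁ v u ≡ false × inCover u ≡ false
    F-member {u} Fu with adj G v u | w v u | E₁ v u | inCover u
    F-member ()  | false | _     | _     | _
    F-member ()  | true  | false | _     | _
    F-member ()  | true  | true  | true  | _
    F-member ()  | true  | true  | false | true
    F-member _   | true  | true  | false | false = refl , refl , refl , refl

    F⇒adj : ∀ {u} → F u ≡ true → adj G v u ≡ true
    F⇒adj = proj₁ ∘ F-member

    F⇒weighted : ∀ {u} → F u ≡ true → w v u ≡ true
    F⇒weighted = proj₁ ∘ proj₂ ∘ F-member

    F⇒∉E₁ : ∀ {u} → F u ≡ true → E₁ v u ≡ false
    F⇒∉E₁ = proj₁ ∘ proj₂ ∘ proj₂ ∘ F-member

    F⇒∉S : ∀ {u} → F u ≡ true → inCover u ≡ false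
    F⇒∉S = proj₂ ∘ proj₂ ∘ proj₂ ∘ F-member

    F-avoids-cover : ∀ {P : Fin n → Bool} → (∀ x → P x ≡ true → F x ≡ true) →
                     ∀ {q} → inCover q ≡ true → P q ≡ false
    F-avoids-cover {P} P⊆F {q} q∈S with P q in Pq
    ... | false = refl
    ... | true  = contradiction (trans (sym q∈S) (F⇒∉S (P⊆F q Pq))) λ ()

    freeDegree≤ : freeDegree G E₁ w v ≤ count F + k
    freeDegree≤ = begin
      freeDegree G E₁ w v                   ≤⟨ sum-mono-≤ pointwise ⟩
      ∑[ u < n ] (⟦ F u ⟧ + ⟦ inCover u ⟧)  ≡⟨ ∑-distrib-+ (⟦_⟧ ∘ F) (⟦_⟧ ∘ inCover) ⟩
      count F + count inCover               ≡⟨ cong (count F +_) (count-lookup S) ⟩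
      count F + k                           ∎
      where
      open ≤-Reasoning
      pointwise : ∀ u → ⟦ free G E₁ w v u ⟧ ≤ ⟦ F u ⟧ + ⟦ inCover u ⟧
      pointwise u with free G E₁ w v u | inCover u
      ... | false | _     = z≤n
      ... | true  | true  = ≤-refl
      ... | true  | false = ≤-refl

    blocks : Fin n → Fin n → Bool
    blocks y u = inCover y ∧ (adj G u y ∧ does (suc (c y) ≟ℕ c u))

    blocks-intro : ∀ {y u} → inCover y ≡ true → adj G u y ≡ true → suc (c y) ≡ c u →
                   blocks y u ≡ true
    blocks-intro {y} {u} y∈S uy step rewrite y∈S | uy | dec-true (suc (c y) ≟ℕ c u) step = refl

    blocks⇒adj : ∀ {y u} → blocks y u ≡ true → adj G u y ≡ true
    blocks⇒adj {y} {u} b = ∧-conicalˡ (adj G u y) _ (∧-conicalʳ (inCover y) _ b)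

    blocks⇒step : ∀ {y u} → blocks y u ≡ true → suc (c y) ≡ c u
    blocks⇒step {y} {u} b =
      does⇒ (suc (c y) ≟ℕ c u) (∧-conicalʳ (adj G u y) _ (∧-conicalʳ (inCover y) _ b))

    blockers : Fin n → ℕ
    blockers u = count (λ y → blocks y u)

    unblocked : Fin n → Bool
    unblocked u = F u ∧ does (blockers u ≟ℕ 0)

    unblocked⇒¬blocks : ∀ {y u} → unblocked u ≡ true → blocks y u ≢ true
    unblocked⇒¬blocks {y} {u} unbl blocked =
      <⇒≢ (member⇒count>0 (λ y → blocks y u) blocked) (sym no-blockers)
      where
      no-blockers : blockers u ≡ 0
      no-blockers = does⇒ (blockers u ≟ℕ 0) (∧-conicalʳ (F u) (does (blockers u ≟ℕ 0)) unbl)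

    load : Fin n → ℕ
    load y = count (λ u → F u ∧ blocks y u)

    F-split : count F ≤ count unblocked + ∑[ y < n ] load y
    F-split = begin
      count F                                            ≤⟨ sum-mono-≤ pointwise ⟩
      ∑[ u < n ] (⟦ unblocked u ⟧ + ∑[ y < n ] δ u y)    ≡⟨ ∑-distrib-+ (⟦_⟧ ∘ unblocked) _ ⟩
      count unblocked + ∑[ u < n ] ∑[ y < n ] δ u y      ≡⟨ cong (count unblocked +_) (∑-comm δ) ⟩
      count unblocked + ∑[ y < n ] load y                ∎
      where
      open ≤-Reasoning
      δ : Fin n → Fin n → ℕ
      δ u y = ⟦ F u ∧ blocks y u ⟧
      pointwise : ∀ u → ⟦ F u ⟧ ≤ ⟦ F u ∧ does (blockers u ≟ℕ 0) ⟧ + ∑[ y < n ] δ u y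
      pointwise u with F u
      ... | false = z≤n
      ... | true  = one≤ (blockers u)
        where
        one≤ : ∀ m → 1 ≤ ⟦ does (m ≟ℕ 0) ⟧ + m
        one≤ zero    = ≤-refl
        one≤ (suc m) = s≤s z≤n

    light-loads-impossible : count unblocked ≤ 2 * k →
                             (∀ y → inCover y ≡ true → load y ≤ 8 * k + 5) → ⊥
    light-loads-impossible few light =
      <⇒≱ overloaded (light-loads-bound k freeDegree≤ F-split few loads≤)
      where
      open ≤-Reasoning
      bounded-by : ∀ {y} s → inCover y ≡ s → load y ≤ ⟦ s ⟧ * (8 * k + 5)
      bounded-by {y} true  y∈S = subst (load y ≤_) (sym (+-identityʳ _)) (light y y∈S)
      bounded-by {y} false y∉S = ≤-reflexive (count-∧-false {P = F} λ u _ →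
                                   cong (_∧ (adj G u y ∧ does (suc (c y) ≟ℕ c u))) y∉S)
      loads≤ : ∑[ y < n ] load y ≤ k * (8 * k + 5)
      loads≤ = begin
        ∑[ y < n ] load y                         ≤⟨ sum-mono-≤ (λ y → bounded-by (inCover y) refl) ⟩
        ∑[ y < n ] (⟦ inCover y ⟧ * (8 * k + 5))  ≡⟨ *-distribʳ-sum (8 * k + 5) (⟦_⟧ ∘ inCover) ⟨
        count inCover * (8 * k + 5)               ≡⟨ cong (_* (8 * k + 5)) (count-lookup S) ⟩
        k * (8 * k + 5)                           ∎

    module Unload (A : Fin n → Bool) (A⊆F : ∀ x → A x ≡ true → F x ≡ true) where

      open Toggle G w v A (λ z → F⇒adj ∘ A⊆F z) public

      A-weighted : ∀ z → A z ≡ true → w v z ≡ true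
      A-weighted z = F⇒weighted ∘ A⊆F z

      unloaded-center : color G toggled v + count A ≡ c v
      unloaded-center = removal-center A-weighted

      unloaded-member : ∀ {x} → A x ≡ true → color G toggled x + 1 ≡ c x
      unloaded-member = removal-member w-sym A-weighted

      unloaded-extends : Extends E₁ toggled
      unloaded-extends = toggled-extends E₁-sym w-ext (λ z → F⇒∉E₁ ∘ A⊆F z)

    module ManyUnblocked (t : ℕ) (t≤2k : t ≤ 2 * k)
                         (avoids : ∀ x → inCover x ≡ true → c v ∸ c x ≢ suc t)
                         (A : Fin n → Bool) (A⊆unblocked : ∀ x → A x ≡ true → unblocked x ≡ true)
                         (∣A∣≡1+t : count A ≡ suc t) where

      A⇒F : ∀ x → A x ≡ true → F x ≡ true
      A⇒F x Ax = ∧-conicalˡ (F x) _ (A⊆unblocked x Ax)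

      open Unload A A⇒F

      c′ : Fin n → ℕ
      c′ = color G toggled

      c′v+1+t : c′ v + suc t ≡ c v
      c′v+1+t = trans (cong (c′ v +_) (sym ∣A∣≡1+t)) unloaded-center

      c′v<cv : c′ v < c v
      c′v<cv = subst (c′ v <_) c′v+1+t (m<m+n (c′ v) (s≤s z≤n))

      c′v>4k : 4 * k < c′ v
      c′v>4k = high-after-unloading k k≥1 (≤-trans (s≤s t≤2k) (1+2k≤3k+1 k))
                                    (subst (_ <_) (sym c′v+1+t) cv>bound)

      c′≤c : ∀ x → c′ x ≤ c x
      c′≤c x = from-changes (color-changes x)
        where
        from-changes : (x ≡ v ⊎ A x ≡ true) ⊎ c′ x ≡ c x → c′ x ≤ c x
        from-changes (inj₁ (inj₁ x≡v)) = subst (λ x → c′ x ≤ c x) (sym x≡v) (<⇒≤ c′v<cv)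
        from-changes (inj₁ (inj₂ Ax))  = subst (c′ x ≤_) (unloaded-member Ax) (m≤m+n (c′ x) 1)
        from-changes (inj₂ same)       = ≤-reflexive same

      center-ok : ∀ q → adj G v q ≡ true → c′ v ≢ c′ q
      center-ok q vq c′v≡c′q = by-membership (inCover q) refl
        where
        by-membership : ∀ s → inCover q ≡ s → ⊥
        by-membership false q∉S = <⇒≱ c′v>4k (begin
          c′ v   ≡⟨ c′v≡c′q ⟩
          c′ q   ≤⟨ c′≤c q ⟩
          c q    ≤⟨ color-outside-cover w q∉S ⟩
          k      ≤⟨ m≤m+n k _ ⟩
          4 * k  ∎)
          where open ≤-Reasoning
        by-membership true q∈S = avoids q q∈S (begin
          c v ∸ c q               ≡⟨ cong (c v ∸_) c′q≡cq ⟨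
          c v ∸ c′ q              ≡⟨ cong (c v ∸_) c′v≡c′q ⟨
          c v ∸ c′ v              ≡⟨ cong (_∸ c′ v) c′v+1+t ⟨
          c′ v + suc t ∸ c′ v     ≡⟨ m+n∸m≡n (c′ v) (suc t) ⟩
          suc t                   ∎)
          where
          open ≡-Reasoning
          c′q≡cq : c′ q ≡ c q
          c′q≡cq = color-other (adj⇒≢ G vq ∘ sym) (F-avoids-cover A⇒F q∈S)

      member-ok : ∀ {p q} → A p ≡ true → adj G p q ≡ true → q ≢ v → c′ p ≢ c′ q
      member-ok {p} {q} Ap pq q≢v c′p≡c′q =
        unblocked⇒¬blocks (A⊆unblocked p Ap) (blocks-intro q∈S pq (begin
          suc (c q)   ≡⟨ cong suc (color-other q≢v (F-avoids-cover A⇒F q∈S)) ⟨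
          suc (c′ q)  ≡⟨ cong suc c′p≡c′q ⟨
          suc (c′ p)  ≡⟨ +-comm 1 (c′ p) ⟩
          c′ p + 1    ≡⟨ unloaded-member Ap ⟩
          c p         ∎))
        where
        open ≡-Reasoning
        q∈S : inCover q ≡ true
        q∈S = neighbor-in-cover (F⇒∉S (A⇒F p Ap)) pq

      c′-proper : IsProperColoring G c′
      c′-proper = recolor-proper {G = G} {c = c} (λ x → x ≡ v ⊎ A x ≡ true)
                                 color-changes changed-ok w-proper
        where
        changed-ok : ∀ p q → adj G p q ≡ true → p ≡ v ⊎ A p ≡ true → c′ p ≢ c′ q
        changed-ok p q pq (inj₁ refl) = center-ok q pq
        changed-ok p q pq (inj₂ Ap)   = case q ≟ v of λ where
          (yes refl) → center-ok p (adj-sym G pq) ∘ sym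
          (no  q≢v)  → member-ok Ap pq q≢v

      improvement : ∃[ w′ ] (ProperExtension w′ × excess w′ < excess w)
      improvement = toggled
                  , ((toggled-sym w-sym , c′-proper) , unloaded-extends)
                  , excess-< (λ x → ∸-monoˡ-≤ (4 * k) (c′≤c x)) v c′v<cv (<-trans c′v>4k c′v<cv)

    many-unblocked : 2 * k < count unblocked → ∃[ w′ ] (ProperExtension w′ × excess w′ < excess w)
    many-unblocked enough =
      let t , t≤k+k , avoids = fresh-offset-avoiding 1 S (λ x → c v ∸ c x) (λ x → c v ∸ c x)
          t≤2k = t≤k+k⇒t≤2k k t≤k+k
          A , A⊆unblocked , ∣A∣ = subset-ofSize unblocked (≤-trans (s≤s t≤2k) enough)
      in ManyUnblocked.improvement t t≤2k (λ x → proj₁ ∘ avoids x) A A⊆unblocked ∣A∣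

    module HeavyBlocker (y : Fin n) (y∈S : inCover y ≡ true) (heavy : 8 * k + 5 < load y) where

      cy<k : c y < k
      cy<k = let u , u-blocked = count>0⇒member (λ u → F u ∧ blocks y u) (≤-trans (s≤s z≤n) heavy) in
        ≤-trans (≤-reflexive (blocks⇒step (∧-conicalʳ (F u) _ u-blocked)))
                (color-outside-cover w (F⇒∉S (∧-conicalˡ (F u) _ u-blocked)))

      y≢v : y ≢ v
      y≢v y≡v = <⇒≱ (subst (λ x → c x < k) y≡v cy<k)
                    (≤-trans (≤-trans (m≤m+n k (7 * k)) (m≤n+m (8 * k) (8 * (k * k)))) (<⇒≤ cv>bound))

      U : Fin n → Bool
      U u = (F u ∧ blocks y u) ∧ not (w y u)

      U-large : 3 * k + 1 ≤ count U
      U-large = heavy-load-leaves-room k heavy load≤ cy<k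
        where
        open ≤-Reasoning
        split : ∀ a b e → (a ≡ true → b ≡ true) → ⟦ a ⟧ ≤ ⟦ a ∧ not e ⟧ + ⟦ b ∧ e ⟧
        split false _ _     _   = z≤n
        split true  _ false _   = m≤m+n 1 _
        split true  b true  a⇒b rewrite a⇒b refl = ≤-refl
        pointwise : ∀ u → ⟦ F u ∧ blocks y u ⟧ ≤ ⟦ U u ⟧ + ⟦ adj G y u ∧ w y u ⟧
        pointwise u = split (F u ∧ blocks y u) (adj G y u) (w y u)
                            (λ blocked → adj-sym G (blocks⇒adj (∧-conicalʳ (F u) _ blocked)))
        load≤ : load y ≤ count U + c y
        load≤ = begin
          load y                                        ≤⟨ sum-mono-≤ pointwise ⟩
          ∑[ u < n ] (⟦ U u ⟧ + ⟦ adj G y u ∧ w y u ⟧)  ≡⟨ ∑-distrib-+ (⟦_⟧ ∘ U) _ ⟩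
          count U + ∑[ u < n ] ⟦ adj G y u ∧ w y u ⟧    ≡⟨ cong (count U +_) (color≡∑ G w y) ⟨
          count U + c y                                 ∎

      module Transfer (t : ℕ) (t≤k+k : t ≤ k + k)
                      (avoids : ∀ x → inCover x ≡ true →
                                  c x ∸ c y ≢ suc k + t × c v ∸ c x ≢ suc k + t)
                      (A : Fin n → Bool) (A⊆U : ∀ x → A x ≡ true → U x ≡ true)
                      (∣A∣≡b : count A ≡ suc k + t) where

        b : ℕ
        b = suc k + t

        A⇒F∧blocked : ∀ {x} → A x ≡ true → F x ∧ blocks y x ≡ true
        A⇒F∧blocked {x} Ax = ∧-conicalˡ (F x ∧ blocks y x) _ (A⊆U x Ax)

        A⇒F : ∀ x → A x ≡ true → F x ≡ true
        A⇒F x Ax = ∧-conicalˡ (F x) _ (A⇒F∧blocked Ax)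

        A⇒adj-y : ∀ x → A x ≡ true → adj G y x ≡ true
        A⇒adj-y x Ax = adj-sym G (blocks⇒adj (∧-conicalʳ (F x) _ (A⇒F∧blocked Ax)))

        y∉A : A y ≡ false
        y∉A = F-avoids-cover A⇒F y∈S

        module Off = Unload A A⇒F

        w₁ : EdgeFun n
        w₁ = Off.toggled

        w₁-sym : Symmetric w₁
        w₁-sym = Off.toggled-sym w-sym

        A-unweighted₁ : ∀ x → A x ≡ true → w₁ y x ≡ false
        A-unweighted₁ x Ax = trans (Off.toggled-other y≢v y∉A x)
                                   (not-injective (∧-conicalʳ (F x ∧ blocks y x) _ (A⊆U x Ax)))

        module On = Toggle G w₁ y A A⇒adj-y

        c₂ : Fin n → ℕ
        c₂ = color G On.toggled

        c₂v+b : c₂ v + b ≡ c v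
        c₂v+b = begin
          c₂ v + b                ≡⟨ cong₂ _+_ (On.color-other (y≢v ∘ sym) Off.v∉A) (sym ∣A∣≡b) ⟩
          color G w₁ v + count A  ≡⟨ Off.unloaded-center ⟩
          c v                     ∎
          where open ≡-Reasoning

        c₂y≡cy+b : c₂ y ≡ c y + b
        c₂y≡cy+b = begin
          c₂ y                    ≡⟨ On.addition-center A-unweighted₁ ⟩
          color G w₁ y + count A  ≡⟨ cong₂ _+_ (Off.color-other y≢v y∉A) ∣A∣≡b ⟩
          c y + b                 ∎
          where open ≡-Reasoning

        c₂-member : ∀ {x} → A x ≡ true → c₂ x ≡ c x
        c₂-member Ax = trans (On.addition-member w₁-sym A-unweighted₁ Ax) (Off.unloaded-member Ax)

        c₂-changes : ∀ x → (x ≡ v ⊎ x ≡ y) ⊎ c₂ x ≡ c x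
        c₂-changes x = combine (Off.color-changes x) (On.color-changes x)
          where
          combine : (x ≡ v ⊎ A x ≡ true) ⊎ color G w₁ x ≡ c x →
                    (x ≡ y ⊎ A x ≡ true) ⊎ c₂ x ≡ color G w₁ x →
                    (x ≡ v ⊎ x ≡ y) ⊎ c₂ x ≡ c x
          combine (inj₁ (inj₁ x≡v)) _                 = inj₁ (inj₁ x≡v)
          combine _                 (inj₁ (inj₁ x≡y)) = inj₁ (inj₂ x≡y)
          combine (inj₁ (inj₂ Ax))  _                 = inj₂ (c₂-member Ax)
          combine (inj₂ _)          (inj₁ (inj₂ Ax))  = inj₂ (c₂-member Ax)
          combine (inj₂ same₁)      (inj₂ same₂)      = inj₂ (trans same₂ same₁)

        c₂-elsewhere : ∀ {x} → x ≢ v → x ≢ y → c₂ x ≡ c x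
        c₂-elsewhere {x} x≢v x≢y =
          [ [ flip contradiction x≢v , flip contradiction x≢y ]′ , id ]′ (c₂-changes x)

        b≤3k+1 : b ≤ 3 * k + 1
        b≤3k+1 = 1+k+t≤3k+1 k t≤k+k

        c₂v<cv : c₂ v < c v
        c₂v<cv = subst (c₂ v <_) c₂v+b (m<m+n (c₂ v) (s≤s z≤n))

        c₂v>4k : 4 * k < c₂ v
        c₂v>4k = high-after-unloading k k≥1 b≤3k+1 (subst (_ <_) (sym c₂v+b) cv>bound)

        c₂y≤4k : c₂ y ≤ 4 * k
        c₂y≤4k = subst (_≤ 4 * k) (sym c₂y≡cy+b) (low-after-loading k cy<k b≤3k+1)

        c₂y>k : k < c₂ y
        c₂y>k = subst (k <_) (sym c₂y≡cy+b) (≤-trans (s≤s (m≤m+n k t)) (m≤n+m b (c y)))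

        center-ok : ∀ q → adj G v q ≡ true → c₂ v ≢ c₂ q
        center-ok q vq c₂v≡c₂q = locate (q ≟ y) (inCover q) refl
          where
          locate : Dec (q ≡ y) → ∀ s → inCover q ≡ s → ⊥
          locate (yes q≡y) _ _ =
            <⇒≱ c₂v>4k (≤-trans (≤-reflexive (trans c₂v≡c₂q (cong c₂ q≡y))) c₂y≤4k)
          locate (no  q≢y) false q∉S = <⇒≱ c₂v>4k (begin
            c₂ v   ≡⟨ c₂v≡c₂q ⟩
            c₂ q   ≡⟨ c₂-elsewhere (adj⇒≢ G vq ∘ sym) q≢y ⟩
            c q    ≤⟨ color-outside-cover w q∉S ⟩
            k      ≤⟨ m≤m+n k _ ⟩
            4 * k  ∎)
            where open ≤-Reasoning
          locate (no  q≢y) true q∈S = proj₂ (avoids q q∈S) (begin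
            c v ∸ c q        ≡⟨ cong (c v ∸_) (c₂-elsewhere (adj⇒≢ G vq ∘ sym) q≢y) ⟨
            c v ∸ c₂ q       ≡⟨ cong (c v ∸_) c₂v≡c₂q ⟨
            c v ∸ c₂ v       ≡⟨ cong (_∸ c₂ v) c₂v+b ⟨
            c₂ v + b ∸ c₂ v  ≡⟨ m+n∸m≡n (c₂ v) b ⟩
            b                ∎)
            where open ≡-Reasoning

        hub-ok : ∀ {q} → adj G y q ≡ true → q ≢ v → c₂ y ≢ c₂ q
        hub-ok {q} yq q≢v c₂y≡c₂q = by-membership (inCover q) refl
          where
          c₂q≡cq : c₂ q ≡ c q
          c₂q≡cq = c₂-elsewhere q≢v (adj⇒≢ G yq ∘ sym)
          by-membership : ∀ s → inCover q ≡ s → ⊥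
          by-membership false q∉S = <⇒≱ c₂y>k (begin
            c₂ y  ≡⟨ c₂y≡c₂q ⟩
            c₂ q  ≡⟨ c₂q≡cq ⟩
            c q   ≤⟨ color-outside-cover w q∉S ⟩
            k     ∎)
            where open ≤-Reasoning
          by-membership true q∈S = proj₁ (avoids q q∈S) (begin
            c q ∸ c y      ≡⟨ cong (_∸ c y) c₂q≡cq ⟨
            c₂ q ∸ c y     ≡⟨ cong (_∸ c y) c₂y≡c₂q ⟨
            c₂ y ∸ c y     ≡⟨ cong (_∸ c y) c₂y≡cy+b ⟩
            c y + b ∸ c y  ≡⟨ m+n∸m≡n (c y) b ⟩
            b              ∎)
            where open ≡-Reasoning

        c₂-proper : IsProperColoring G c₂
        c₂-proper = recolor-proper {G = G} {c = c} (λ x → x ≡ v ⊎ x ≡ y)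
                                   c₂-changes changed-ok w-proper
          where
          changed-ok : ∀ p q → adj G p q ≡ true → p ≡ v ⊎ p ≡ y → c₂ p ≢ c₂ q
          changed-ok p q pq (inj₁ refl) = center-ok q pq
          changed-ok p q pq (inj₂ refl) = case q ≟ v of λ where
            (yes refl) → center-ok p (adj-sym G pq) ∘ sym
            (no  q≢v)  → hub-ok pq q≢v

        excess-pointwise : ∀ x → c₂ x ∸ 4 * k ≤ c x ∸ 4 * k
        excess-pointwise x = from-changes (c₂-changes x)
          where
          from-changes : (x ≡ v ⊎ x ≡ y) ⊎ c₂ x ≡ c x → c₂ x ∸ 4 * k ≤ c x ∸ 4 * k
          from-changes (inj₁ (inj₁ x≡v)) =
            subst (λ x → c₂ x ∸ 4 * k ≤ c x ∸ 4 * k) (sym x≡v) (∸-monoˡ-≤ (4 * k) (<⇒≤ c₂v<cv))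
          from-changes (inj₁ (inj₂ x≡y)) = subst (_≤ c x ∸ 4 * k) (sym (m≤n⇒m∸n≡0 c₂x≤4k)) z≤n
            where
            c₂x≤4k : c₂ x ≤ 4 * k
            c₂x≤4k = subst (λ x → c₂ x ≤ 4 * k) (sym x≡y) c₂y≤4k
          from-changes (inj₂ same)       = ≤-reflexive (cong (_∸ 4 * k) same)

        w₂-extends : Extends E₁ On.toggled
        w₂-extends = On.toggled-extends E₁-sym Off.unloaded-extends
                                        (λ x → unweighted⇒∉E₁ Off.unloaded-extends ∘ A-unweighted₁ x)

        improvement : ∃[ w′ ] (ProperExtension w′ × excess w′ < excess w)
        improvement = On.toggled
                    , ((On.toggled-sym w₁-sym , c₂-proper) , w₂-extends)
                    , excess-< excess-pointwise v c₂v<cv (<-trans c₂v>4k c₂v<cv)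

      transfer : ∃[ w′ ] (ProperExtension w′ × excess w′ < excess w)
      transfer =
        let t , t≤k+k , avoids = fresh-offset-avoiding (suc k) S (λ x → c x ∸ c y) (λ x → c v ∸ c x)
            A , A⊆U , ∣A∣ = subset-ofSize U (≤-trans (1+k+t≤3k+1 k t≤k+k) U-large)
        in Transfer.improvement t t≤k+k avoids A A⊆U ∣A∣

    heavy? : ∀ y → Dec (inCover y ≡ true × 8 * k + 5 < load y)
    heavy? y = (inCover y Bool.≟ true) ×-dec (8 * k + 5 <? load y)

    improvement : ∃[ w′ ] (ProperExtension w′ × excess w′ < excess w)
    improvement = case 2 * k <? count unblocked of λ where
      (yes many) → many-unblocked many
      (no  few)  → case any? heavy? of λ where
        (yes (y , y∈S , heavy)) → HeavyBlocker.transfer y y∈S heavy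
        (no  none)              → ⊥-elim (light-loads-impossible (≮⇒≥ few)
                                    λ y y∈S → ≮⇒≥ λ heavy → none (y , y∈S , heavy))

  balanced? : ∀ w v → Dec (freeDegree G E₁ w v ≤ 8 * (k * k) + 8 * k)
  balanced? w v = freeDegree G E₁ w v ≤? 8 * (k * k) + 8 * k

  improve-or-balanced : ∀ w → ProperExtension w →
                        (∀ v → freeDegree G E₁ w v ≤ 8 * (k * k) + 8 * k) ⊎
                        ∃[ w′ ] (ProperExtension w′ × excess w′ < excess w)
  improve-or-balanced w proper-ext = case all? (balanced? w) of λ where
    (yes balanced)   → inj₁ balanced
    (no  unbalanced) → let v , overloaded = ¬∀⟶∃¬ n _ (balanced? w) unbalanced in
                       inj₂ (Overloaded.improvement w proper-ext v (≰⇒> overloaded))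

  balanced-extension : ∀ w → ProperExtension w →
                       ∃[ ŵ ] (ProperExtension ŵ × ∀ v → freeDegree G E₁ ŵ v ≤ 8 * (k * k) + 8 * k)
  balanced-extension = descend excess improve-or-balanced

mainTheorem10 : (n : ℕ) (G : Graph n) → NoIsolatedEdge G →
    (k : ℕ) → VertexCoverNumber G k →
    (E₁ : EdgeFun n) → IsEdgeSubset G E₁ →
    (∃[ w' ] (IsProperWeighting G w' × Extends E₁ w')) →
    ∃[ ŵ ] (IsProperWeighting G ŵ × Extends E₁ ŵ ×
      (∀ v → color G ŵ v ∸ base G E₁ v ≤ 8 * (k * k) + 8 * k))
mainTheorem10 n G _ k ((S , S-cover , ∣S∣≡k) , _) E₁ (E₁-sym , _) (w₀ , w₀-proper-ext) =
  let ŵ , (ŵ-proper , ŵ-extends) , ŵ-balanced = balanced-extension w₀ w₀-proper-ext in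
  ŵ , ŵ-proper , ŵ-extends , λ v → begin
    color G ŵ v ∸ base G E₁ v        ≡⟨ color∸base≡freeDegree G E₁ ŵ ŵ-extends v ⟩
    freeDegree G E₁ ŵ v              ≤⟨ ŵ-balanced v ⟩
    8 * (∣ S ∣ * ∣ S ∣) + 8 * ∣ S ∣  ≡⟨ cong (λ m → 8 * (m * m) + 8 * m) ∣S∣≡k ⟩
    8 * (k * k) + 8 * k              ∎
  where
  open Rebalancing G E₁ E₁-sym S S-cover using (balanced-extension)
  open ≤-Reasoning
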